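{- Let $(\mathbf{M},\mathbf{N})$ be an $\mathrm{IMLU}$-category. A morphism $m:A\to B$ of $\mathbf{SCan}_{(\mathbf{M},\mathbf{N})}$ is monic in $\mathbf{SCan}_{(\mathbf{M},\mathbf{N})}$ if and only if it is monic in $\mathbf{N}$.
   Context: Heyting category: finite limits, images, covers stable under pullback, each subobject poset a join-semilattice, each pullback map $f^*$ preserving finite joins with adjoints $\exists_f\dashv f^*\dashv\forall_f$. An $\mathrm{IMLU}$-category is a pair $(\mathbf{M},\mathbf{N})$ of Heyting categories with $\mathbf{N}$ a conservative (isomorphism-reflecting) Heyting subcategory of $\mathbf{M}$, together with: an object $U$ of $\mathbf{N}$ such that every object of $\mathbf{N}$ has a mono in $\mathbf{N}$ into $U$; an endofunctor $\mathbf{T}$ of $\mathbf{M}$ restricting to an endofunctor of $\mathbf{N}$ and a natural isomorphism $\iota:\mathrm{id}_\mathbf{M}\to\mathbf{T}$; an endofunctor $\mathbf{P}$ of $\mathbf{N}$ such that for each object $A$ of $\mathbf{N}$ there is $m_{\subseteq^\mathbf{T}_A}:\subseteq^\mathbf{T}_A\to\mathbf{T}A\times\mathbf{P}A$ in $\mathbf{N}$, monic in $\mathbf{M}$, such that for each $r:R\to\mathbf{T}A\times B$ in $\mathbf{N}$ monic in $\mathbf{M}$ there is $\chi:B\to\mathbf{P}A$ in $\mathbf{N}$ which is the unique morphism of $\mathbf{M}$ for which $r$ is a pullback in $\mathbf{M}$ of $m_{\subseteq^\mathbf{T}_A}$ along $\mathrm{id}\times\chi$; and a natural isomorphism $\mu:\mathbf{P}\mathbf{T}\to\mathbf{T}\mathbf{P}$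 on $\mathbf{N}$. An object $X$ of $\mathbf{N}$ is strongly Cantorian if $\iota_X$ is an isomorphism in $\mathbf{N}$. $\mathbf{SCan}_{(\mathbf{M},\mathbf{N})}$ is the full subcategory of $\mathbf{N}$ on strongly Cantorian objects. -}

module Defs where

open import Level using (Level; _⊔_) renaming (suc to lsuc)
open import Relation.Binary using (Rel; IsEquivalence)
open import Data.Product using (Σ; _×_; _,_; proj₁; proj₂; Σ-syntax)
open import Function.Bundles using (_⇔_)

record Category (o ℓ e : Level) : Set (lsuc (o ⊔ ℓ ⊔ e)) where
  infixr 9 _∘_
  infix 4 _≈_
  infixr 5 _⇒_
  field
    Obj       : Set o
    _⇒_       : Obj → Obj → Set ℓ
    _≈_       : ∀ {A B} → Rel (A ⇒ B) e
    id        : ∀ {A} → A ⇒ A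
    _∘_       : ∀ {A B C} → B ⇒ C → A ⇒ B → A ⇒ C
    equiv     : ∀ {A B} → IsEquivalence (_≈_ {A} {B})
    ∘-resp-≈  : ∀ {A B C} {f h : B ⇒ C} {g i : A ⇒ B} →
                f ≈ h → g ≈ i → f ∘ g ≈ h ∘ i
    identityˡ : ∀ {A B} {f : A ⇒ B} → id ∘ f ≈ f
    identityʳ : ∀ {A B} {f : A ⇒ B} → f ∘ id ≈ f
    assoc     : ∀ {A B C D} {f : A ⇒ B} {g : B ⇒ C} {h : C ⇒ D} →
                (h ∘ g) ∘ f ≈ h ∘ (g ∘ f)

record Functor {o ℓ e o′ ℓ′ e′ : Level}
               (C : Category o ℓ e) (D : Category o′ ℓ′ e′)
               : Set (o ⊔ ℓ ⊔ e ⊔ o′ ⊔ ℓ′ ⊔ e′) where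
  private
    module C = Category C
    module D = Category D
  field
    F₀           : C.Obj → D.Obj
    F₁           : ∀ {A B} → A C.⇒ B → F₀ A D.⇒ F₀ B
    identity     : ∀ {A} → F₁ (C.id {A}) D.≈ D.id
    homomorphism : ∀ {A B X} {f : A C.⇒ B} {g : B C.⇒ X} →
                   F₁ (g C.∘ f) D.≈ F₁ g D.∘ F₁ f
    F-resp-≈     : ∀ {A B} {f g : A C.⇒ B} → f C.≈ g → F₁ f D.≈ F₁ g

record Subcategory {o ℓ e : Level} (C : Category o ℓ e) : Set (lsuc (o ⊔ ℓ) ⊔ e) where
  open Category C
  field
    ObjP     : Obj → Set o
    HomP     : ∀ {A B} → A ⇒ B → Set ℓ
    HomP-≈   : ∀ {A B} {f g : A ⇒ B} → f ≈ g → HomP f → HomP g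
    HomP-id  : ∀ {A} → ObjP A → HomP (id {A})
    HomP-∘   : ∀ {A B X} {f : A ⇒ B} {g : B ⇒ X} → HomP f → HomP g → HomP (g ∘ f)

record SubHom {o ℓ e : Level} (C : Category o ℓ e) (S : Subcategory C)
              (A B : Σ (Category.Obj C) (Subcategory.ObjP S)) : Set ℓ where
  constructor _,ₕ_
  field
    mor  : Category._⇒_ C (proj₁ A) (proj₁ B)
    prop : Subcategory.HomP S mor

⌊_⌋ : ∀ {o ℓ e} {C : Category o ℓ e} {S : Subcategory C} {A B} →
      SubHom C S A B → Category._⇒_ C (proj₁ A) (proj₁ B)
⌊ f ⌋ = SubHom.mor f

SubCat : ∀ {o ℓ e} (C : Category o ℓ e) → Subcategory C → Category o ℓ e
SubCat C S = record
  { Obj       = Σ Obj ObjP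
  ; _⇒_       = SubHom C S
  ; _≈_       = λ f g → ⌊ f ⌋ ≈ ⌊ g ⌋
  ; id        = λ {A} → id ,ₕ HomP-id (proj₂ A)
  ; _∘_       = λ g f → (⌊ g ⌋ ∘ ⌊ f ⌋) ,ₕ HomP-∘ (SubHom.prop f) (SubHom.prop g)
  ; equiv     = record { refl = IsEquivalence.refl equiv
                       ; sym = IsEquivalence.sym equiv
                       ; trans = IsEquivalence.trans equiv }
  ; ∘-resp-≈  = ∘-resp-≈
  ; identityˡ = identityˡ
  ; identityʳ = identityʳ
  ; assoc     = assoc
  }
  where open Category C
        open Subcategory S

record FullHom {o ℓ e p : Level} (C : Category o ℓ e) (Q : Category.Obj C → Set p)
               (A B : Σ (Category.Obj C) Q) : Set ℓ where
  constructor ⟨_⟩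
  field
    hom : Category._⇒_ C (proj₁ A) (proj₁ B)

FullSub : ∀ {o ℓ e p} (C : Category o ℓ e) → (Category.Obj C → Set p) →
          Category (o ⊔ p) ℓ e
FullSub C Q = record
  { Obj       = Σ Obj Q
  ; _⇒_       = FullHom C Q
  ; _≈_       = λ f g → FullHom.hom f ≈ FullHom.hom g
  ; id        = ⟨ id ⟩
  ; _∘_       = λ g f → ⟨ FullHom.hom g ∘ FullHom.hom f ⟩
  ; equiv     = record { refl = IsEquivalence.refl equiv
                       ; sym = IsEquivalence.sym equiv
                       ; trans = IsEquivalence.trans equiv }
  ; ∘-resp-≈  = ∘-resp-≈
  ; identityˡ = identityˡ
  ; identityʳ = identityʳ
  ; assoc     = assoc
  }
  where open Category C

module Notions {o ℓ e : Level} (C : Category o ℓ e) where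
  open Category C

  Monic : ∀ {A B} → A ⇒ B → Set (o ⊔ ℓ ⊔ e)
  Monic {A} m = ∀ {X} (f g : X ⇒ A) → m ∘ f ≈ m ∘ g → f ≈ g

  IsIso : ∀ {A B} → A ⇒ B → Set (ℓ ⊔ e)
  IsIso {A} {B} f = Σ[ g ∈ B ⇒ A ] ((g ∘ f ≈ id) × (f ∘ g ≈ id))

  IsTerminal : Obj → Set (o ⊔ ℓ ⊔ e)
  IsTerminal T = ∀ X → Σ[ ! ∈ X ⇒ T ] (∀ (h : X ⇒ T) → h ≈ !)

  IsPullback : ∀ {A B X P} (f : A ⇒ X) (g : B ⇒ X) (p₁ : P ⇒ A) (p₂ : P ⇒ B) →
               Set (o ⊔ ℓ ⊔ e)
  IsPullback {A} {B} {X} {P} f g p₁ p₂ =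
    (f ∘ p₁ ≈ g ∘ p₂) ×
    (∀ {Q} (q₁ : Q ⇒ A) (q₂ : Q ⇒ B) → f ∘ q₁ ≈ g ∘ q₂ →
       Σ[ h ∈ Q ⇒ P ] ((p₁ ∘ h ≈ q₁) × (p₂ ∘ h ≈ q₂) ×
         (∀ (h′ : Q ⇒ P) → p₁ ∘ h′ ≈ q₁ → p₂ ∘ h′ ≈ q₂ → h′ ≈ h)))

  record Pullback {A B X} (f : A ⇒ X) (g : B ⇒ X) : Set (o ⊔ ℓ ⊔ e) where
    field
      P          : Obj
      p₁         : P ⇒ A
      p₂         : P ⇒ B
      isPullback : IsPullback f g p₁ p₂

  record Sub (X : Obj) : Set (o ⊔ ℓ ⊔ e) where
    constructor sub
    field
      {dom} : Obj
      arr   : dom ⇒ X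
      monic : Monic arr
  open Sub public

  _≤_ : ∀ {S T X} → S ⇒ X → T ⇒ X → Set (ℓ ⊔ e)
  _≤_ {S} {T} s t = Σ[ h ∈ S ⇒ T ] (t ∘ h ≈ s)

  IsCover : ∀ {A B} → A ⇒ B → Set (o ⊔ ℓ ⊔ e)
  IsCover {A} {B} c = ∀ {S} (m : S ⇒ B) → Monic m → c ≤ m → IsIso m

  IsImage : ∀ {A B} → A ⇒ B → Sub B → Set (o ⊔ ℓ ⊔ e)
  IsImage {A} {B} f I = (f ≤ arr I) × (∀ (J : Sub B) → f ≤ arr J → arr I ≤ arr J)

  IsBottom : ∀ {S X} → S ⇒ X → Set (o ⊔ ℓ ⊔ e)
  IsBottom {S} {X} s = ∀ (T : Sub X) → s ≤ arr T

  IsJoin : ∀ {S T U X} → S ⇒ X → T ⇒ X → U ⇒ X → Set (o ⊔ ℓ ⊔ e)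
  IsJoin {S} {T} {U} {X} s t u =
    (s ≤ u) × (t ≤ u) × (∀ (V : Sub X) → s ≤ arr V → t ≤ arr V → u ≤ arr V)

  -- r represents ∃_f (s), i.e. ∃_f s ≤ T  ⇔  s ≤ f* T  for every T
  IsExistsOf : ∀ {A B S R} (f : A ⇒ B) → S ⇒ A → R ⇒ B → Set (o ⊔ ℓ ⊔ e)
  IsExistsOf {A} {B} f s r =
    ∀ (T : Sub B) {P} (p₁ : P ⇒ A) (p₂ : P ⇒ dom T) → IsPullback f (arr T) p₁ p₂ →
      (r ≤ arr T) ⇔ (s ≤ p₁)

  -- r represents ∀_f (s), i.e. f* T ≤ s  ⇔  T ≤ ∀_f s  for every T
  IsForallOf : ∀ {A B S R} (f : A ⇒ B) → S ⇒ A → R ⇒ B → Set (o ⊔ ℓ ⊔ e)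
  IsForallOf {A} {B} f s r =
    ∀ (T : Sub B) {P} (p₁ : P ⇒ A) (p₂ : P ⇒ dom T) → IsPullback f (arr T) p₁ p₂ →
      (p₁ ≤ s) ⇔ (arr T ≤ r)

  record IsHeyting : Set (o ⊔ ℓ ⊔ e) where
    field
      terminal     : Σ Obj IsTerminal
      pullback     : ∀ {A B X} (f : A ⇒ X) (g : B ⇒ X) → Pullback f g
      image        : ∀ {A B} (f : A ⇒ B) → Σ (Sub B) (IsImage f)
      cover-stable : ∀ {A B X P} {c : A ⇒ X} {g : B ⇒ X} {p₁ : P ⇒ B} {p₂ : P ⇒ A} →
                     IsPullback g c p₁ p₂ → IsCover c → IsCover p₁
      bottom       : ∀ X → Σ (Sub X) (λ S → IsBottom (arr S))
      join         : ∀ {X} (S T : Sub X) → Σ (Sub X) (λ U → IsJoin (arr S) (arr T) (arr U))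
      -- f* preserves finite joins (f* T computed by the chosen pullback)
      pb-bottom    : ∀ {A B} (f : A ⇒ B) (S : Sub B) → IsBottom (arr S) →
                     IsBottom (Pullback.p₁ (pullback f (arr S)))
      pb-join      : ∀ {A B} (f : A ⇒ B) (S T U : Sub B) → IsJoin (arr S) (arr T) (arr U) →
                     IsJoin (Pullback.p₁ (pullback f (arr S)))
                            (Pullback.p₁ (pullback f (arr T)))
                            (Pullback.p₁ (pullback f (arr U)))
      exists       : ∀ {A B} (f : A ⇒ B) → Sub A → Sub B
      exists-adj   : ∀ {A B} (f : A ⇒ B) (S : Sub A) → IsExistsOf f (arr S) (arr (exists f S))
      forall′      : ∀ {A B} (f : A ⇒ B) → Sub A → Sub B
      forall-adj   : ∀ {A B} (f : A ⇒ B) (S : Sub A) → IsForallOf f (arr S) (arr (forall′ f S))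

  module Products (H : IsHeyting) where
    open IsHeyting H
    𝟙 : Obj
    𝟙 = proj₁ terminal
    ! : ∀ X → X ⇒ 𝟙
    ! X = proj₁ (proj₂ terminal X)
    _×ₒ_ : Obj → Obj → Obj
    X ×ₒ Y = Pullback.P (pullback (! X) (! Y))
    π₁ : ∀ {X Y} → X ×ₒ Y ⇒ X
    π₁ {X} {Y} = Pullback.p₁ (pullback (! X) (! Y))
    π₂ : ∀ {X Y} → X ×ₒ Y ⇒ Y
    π₂ {X} {Y} = Pullback.p₂ (pullback (! X) (! Y))

module _ {o ℓ e : Level} (M : Category o ℓ e) (S : Subcategory M) where
  private
    N = SubCat M S
    module M = Notions M
    module N = Notions N

  record IsHeytingInclusion : Set (o ⊔ ℓ ⊔ e) where
    field
      pres-terminal : ∀ (X : Category.Obj N) → N.IsTerminal X → M.IsTerminal (proj₁ X)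
      pres-pullback : ∀ {A B X P} {f : Category._⇒_ N A X} {g : Category._⇒_ N B X}
                        {p₁ : Category._⇒_ N P A} {p₂ : Category._⇒_ N P B} →
                      N.IsPullback f g p₁ p₂ →
                      M.IsPullback ⌊ f ⌋ ⌊ g ⌋ ⌊ p₁ ⌋ ⌊ p₂ ⌋
      pres-cover    : ∀ {A B} (c : Category._⇒_ N A B) → N.IsCover c → M.IsCover ⌊ c ⌋
      pres-bottom   : ∀ {T X} (s : Category._⇒_ N T X) → N.Monic s → N.IsBottom s →
                      M.IsBottom ⌊ s ⌋
      pres-join     : ∀ {T₁ T₂ T₃ X} (s : Category._⇒_ N T₁ X) (t : Category._⇒_ N T₂ X)
                        (u : Category._⇒_ N T₃ X) →
                      N.Monic s → N.Monic t → N.Monic u → N.IsJoin s t u →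
                      M.IsJoin ⌊ s ⌋ ⌊ t ⌋ ⌊ u ⌋
      pres-forall   : ∀ {A B T R} (f : Category._⇒_ N A B) (s : Category._⇒_ N T A)
                        (r : Category._⇒_ N R B) →
                      N.Monic s → N.Monic r → N.IsForallOf f s r →
                      M.IsForallOf ⌊ f ⌋ ⌊ s ⌋ ⌊ r ⌋

  Conservative : Set (o ⊔ ℓ ⊔ e)
  Conservative = ∀ {A B} (f : Category._⇒_ N A B) → M.IsIso ⌊ f ⌋ → N.IsIso f

record IMLU (o ℓ e : Level) : Set (lsuc (o ⊔ ℓ ⊔ e)) where
  field
    M          : Category o ℓ e
    M-heyting  : Notions.IsHeyting M
    Nsub       : Subcategory M

  N : Category o ℓ e
  N = SubCat M Nsub

  open Category M
  open Subcategory Nsub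
  private
    module N  = Category N
    module NN = Notions N
    module MM = Notions M

  field
    N-heyting      : NN.IsHeyting
    N-inclusion    : IsHeytingInclusion M Nsub
    N-conservative : Conservative M Nsub
    U              : N.Obj
    U-universal    : ∀ (X : N.Obj) → Σ (X N.⇒ U) NN.Monic
    T              : Functor M M
    T-obj          : ∀ {X} → ObjP X → ObjP (Functor.F₀ T X)
    T-hom          : ∀ {A B} {f : A ⇒ B} → HomP f → HomP (Functor.F₁ T f)
    ι              : ∀ X → X ⇒ Functor.F₀ T X
    ι-natural      : ∀ {A B} (f : A ⇒ B) → Functor.F₁ T f ∘ ι A ≈ ι B ∘ f
    ι-iso          : ∀ X → MM.IsIso (ι X)
    P              : Functor N N

  Tₙ : N.Obj → N.Obj
  Tₙ X = Functor.F₀ T (proj₁ X) , T-obj (proj₂ X)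

  Tₙ₁ : ∀ {A B} → A N.⇒ B → Tₙ A N.⇒ Tₙ B
  Tₙ₁ f = Functor.F₁ T ⌊ f ⌋ ,ₕ T-hom (SubHom.prop f)

  private
    module Pr = NN.Products N-heyting

  Pₒ : N.Obj → N.Obj
  Pₒ = Functor.F₀ P

  -- r is a pullback in M of m along id × χ, where id × χ is the (unique)
  -- morphism k of M with π₁ ∘ k ≈ π₁ and π₂ ∘ k ≈ χ ∘ π₂
  IsClassifiedBy : ∀ {A B R E} (m : E N.⇒ (Tₙ A Pr.×ₒ Pₒ A))
                   (r : R N.⇒ (Tₙ A Pr.×ₒ B)) (χ : proj₁ B ⇒ proj₁ (Pₒ A)) → Set (o ⊔ ℓ ⊔ e)
  IsClassifiedBy {A} {B} {R} {E} m r χ =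
    Σ[ k ∈ proj₁ (Tₙ A Pr.×ₒ B) ⇒ proj₁ (Tₙ A Pr.×ₒ Pₒ A) ]
      ((⌊ Pr.π₁ {Tₙ A} {Pₒ A} ⌋ ∘ k ≈ ⌊ Pr.π₁ {Tₙ A} {B} ⌋) ×
       (⌊ Pr.π₂ {Tₙ A} {Pₒ A} ⌋ ∘ k ≈ χ ∘ ⌊ Pr.π₂ {Tₙ A} {B} ⌋) ×
       Σ[ q ∈ proj₁ R ⇒ proj₁ E ] MM.IsPullback k ⌊ m ⌋ ⌊ r ⌋ q)

  field
    ⊆ᵀ            : N.Obj → N.Obj
    m⊆ᵀ           : ∀ A → ⊆ᵀ A N.⇒ (Tₙ A Pr.×ₒ Pₒ A)
    m⊆ᵀ-monic     : ∀ A → MM.Monic ⌊ m⊆ᵀ A ⌋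
    classify      : ∀ {A B R} (r : R N.⇒ (Tₙ A Pr.×ₒ B)) → MM.Monic ⌊ r ⌋ →
                    Σ[ χ ∈ B N.⇒ Pₒ A ]
                      (IsClassifiedBy (m⊆ᵀ A) r ⌊ χ ⌋ ×
                       (∀ (χ′ : proj₁ B ⇒ proj₁ (Pₒ A)) →
                          IsClassifiedBy (m⊆ᵀ A) r χ′ → χ′ ≈ ⌊ χ ⌋))
    μ             : ∀ A → Pₒ (Tₙ A) N.⇒ Tₙ (Pₒ A)
    μ-natural     : ∀ {A B} (f : A N.⇒ B) →
                    Tₙ₁ (Functor.F₁ P f) N.∘ μ A N.≈ μ B N.∘ Functor.F₁ P (Tₙ₁ f)
    μ-iso         : ∀ A → NN.IsIso (μ A)

  StronglyCantorian : N.Obj → Set (ℓ ⊔ e)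
  StronglyCantorian X = Σ[ p ∈ HomP (ι (proj₁ X)) ] NN.IsIso {X} {Tₙ X} (ι (proj₁ X) ,ₕ p)

  SCan : Category (o ⊔ ℓ ⊔ e) ℓ e
  SCan = FullSub N StronglyCantorian

module Submission where

-- "Monic in N ⇒ monic in SCan" holds for any full subcategory.  For the
-- converse, m is monic as soon as the two projections of its kernel pair
-- agree; if the kernel pair (computed in N) is an object of SCan, monicity
-- of m in SCan forces exactly that.
-- This follows from the closure of strongly Cantorian objects under
-- pullbacks in N: for a pullback P of A → X ← B of strongly Cantorian
-- objects, the maps j_A ∘ T p₁ and j_B ∘ T p₂ (j the inverse of ι) form a
-- cone in N and induce d : T P → P with d ∘ ι_P = id.  Since ι_P is an
-- isomorphism of M, d is its inverse, and conservativity of N ⊆ M puts ι_P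
-- itself in N as an isomorphism.

open import Defs
open import Level using (Level)
open import Function.Bundles using (_⇔_; mk⇔)
open import Data.Product using (_,_; proj₁; proj₂)
open import Relation.Binary using (IsEquivalence; Setoid)
import Relation.Binary.Reasoning.Setoid as SetoidReasoning

module CategoryFacts {o ℓ e : Level} (C : Category o ℓ e) where
  open Category C
  open Notions C

  module ≈ {A B : Obj} = IsEquivalence (equiv {A} {B})

  hom-setoid : Obj → Obj → Setoid ℓ e
  hom-setoid A B = record { Carrier = A ⇒ B ; _≈_ = _≈_ ; isEquivalence = equiv }

  module HomReasoning {A B : Obj} = SetoidReasoning (hom-setoid A B)

  pullback-jointly-monic : ∀ {A B X P Q} {f : A ⇒ X} {g : B ⇒ X}
                             {p₁ : P ⇒ A} {p₂ : P ⇒ B} →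
                           IsPullback f g p₁ p₂ → (h h′ : Q ⇒ P) →
                           p₁ ∘ h ≈ p₁ ∘ h′ → p₂ ∘ h ≈ p₂ ∘ h′ → h ≈ h′
  pullback-jointly-monic {P = P} {Q} {f} {g} {p₁} {p₂} (square , universal) h h′ eq₁ eq₂ =
    ≈.trans (unique h ≈.refl ≈.refl) (≈.sym (unique h′ (≈.sym eq₁) (≈.sym eq₂)))
    where
      cone : f ∘ (p₁ ∘ h) ≈ g ∘ (p₂ ∘ h)
      cone = ≈.trans (≈.sym assoc) (≈.trans (∘-resp-≈ square ≈.refl) assoc)
      mediator : Q ⇒ P
      mediator = proj₁ (universal (p₁ ∘ h) (p₂ ∘ h) cone)
      unique : ∀ (k : Q ⇒ P) → p₁ ∘ k ≈ p₁ ∘ h → p₂ ∘ k ≈ p₂ ∘ h → k ≈ mediator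
      unique = proj₂ (proj₂ (proj₂ (universal (p₁ ∘ h) (p₂ ∘ h) cone)))

  kernel-pair-monic : ∀ {A B K} {m : A ⇒ B} {q₁ q₂ : K ⇒ A} →
                      IsPullback m m q₁ q₂ → q₁ ≈ q₂ → Monic m
  kernel-pair-monic {K = K} {q₁ = q₁} {q₂} (_ , universal) q₁≈q₂ {X} f g mf≈mg =
    begin
      f       ≈⟨ ≈.sym q₁u≈f ⟩
      q₁ ∘ u  ≈⟨ ∘-resp-≈ q₁≈q₂ ≈.refl ⟩
      q₂ ∘ u  ≈⟨ q₂u≈g ⟩
      g       ∎
    where
      open HomReasoning
      u : X ⇒ K
      u = proj₁ (universal f g mf≈mg)
      q₁u≈f : q₁ ∘ u ≈ f
      q₁u≈f = proj₁ (proj₂ (universal f g mf≈mg))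
      q₂u≈g : q₂ ∘ u ≈ g
      q₂u≈g = proj₁ (proj₂ (proj₂ (universal f g mf≈mg)))

  left-inverse≈right-inverse : ∀ {A B} {d : A ⇒ B} {l r : B ⇒ A} →
                               l ∘ d ≈ id → d ∘ r ≈ id → l ≈ r
  left-inverse≈right-inverse {d = d} {l} {r} ld≈id dr≈id = begin
    l            ≈⟨ ≈.sym identityʳ ⟩
    l ∘ id       ≈⟨ ∘-resp-≈ ≈.refl (≈.sym dr≈id) ⟩
    l ∘ (d ∘ r)  ≈⟨ ≈.sym assoc ⟩
    (l ∘ d) ∘ r  ≈⟨ ∘-resp-≈ ld≈id ≈.refl ⟩
    id ∘ r       ≈⟨ identityˡ ⟩
    r            ∎
    where open HomReasoning

  iso-left-inverse-is-right-inverse : ∀ {A B} {f : A ⇒ B} {g : B ⇒ A} →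
                                      IsIso f → g ∘ f ≈ id → f ∘ g ≈ id
  iso-left-inverse-is-right-inverse {f = f} {g} (f⁻¹ , _ , ff⁻¹≈id) gf≈id =
    ≈.trans (∘-resp-≈ ≈.refl g≈f⁻¹) ff⁻¹≈id
    where
      g≈f⁻¹ : g ≈ f⁻¹
      g≈f⁻¹ = left-inverse≈right-inverse gf≈id ff⁻¹≈id

module FullSubcategoryFacts {o ℓ e p : Level} (C : Category o ℓ e)
                            (Q : Category.Obj C → Set p) where
  open Category C
  private
    D = FullSub C Q

  monic-in-full-sub : ∀ {A B} (m : Category._⇒_ D A B) →
                      Notions.Monic C (FullHom.hom m) → Notions.Monic D m
  monic-in-full-sub m monic f g = monic (FullHom.hom f) (FullHom.hom g)

  monic-from-full-sub : ∀ {A B K} (m : Category._⇒_ D A B)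
                          {q₁ q₂ : K ⇒ proj₁ A} →
                        Notions.IsPullback C (FullHom.hom m) (FullHom.hom m) q₁ q₂ →
                        Q K → Notions.Monic D m → Notions.Monic C (FullHom.hom m)
  monic-from-full-sub m kernel-pair QK monic =
    CategoryFacts.kernel-pair-monic C kernel-pair
      (monic {X = _ , QK} ⟨ _ ⟩ ⟨ _ ⟩ (proj₁ kernel-pair))

module StronglyCantorianFacts {o ℓ e : Level} (I : IMLU o ℓ e) where
  open IMLU I
  open Category M using (_⇒_; _∘_; _≈_; id; assoc; identityˡ; identityʳ; ∘-resp-≈)
  open CategoryFacts M
  module NC = Category N
  module NN = Notions N
  module TF = Functor T

  -- An object of N is strongly Cantorian as soon as ι has a retraction in N:
  -- that retraction is then the inverse of ι in M, and conservativity makes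
  -- it an isomorphism of N whose inverse is ι.
  retraction⇒StronglyCantorian : ∀ (X : NC.Obj) (d : Tₙ X NC.⇒ X) →
                                 ⌊ d ⌋ ∘ ι (proj₁ X) ≈ id → StronglyCantorian X
  retraction⇒StronglyCantorian X d dι≈id =
    Subcategory.HomP-≈ Nsub d⁻¹≈ι (SubHom.prop d⁻¹) , d , dι≈id , ιd≈id
    where
      ιd≈id : ι (proj₁ X) ∘ ⌊ d ⌋ ≈ id
      ιd≈id = iso-left-inverse-is-right-inverse (ι-iso (proj₁ X)) dι≈id
      d-iso : NN.IsIso d
      d-iso = N-conservative d (ι (proj₁ X) , ιd≈id , dι≈id)
      d⁻¹ : X NC.⇒ Tₙ X
      d⁻¹ = proj₁ d-iso
      d⁻¹≈ι : ⌊ d⁻¹ ⌋ ≈ ι (proj₁ X)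
      d⁻¹≈ι = left-inverse≈right-inverse (proj₁ (proj₂ d-iso)) dι≈id

  j : ∀ {X : NC.Obj} → StronglyCantorian X → Tₙ X NC.⇒ X
  j sc = proj₁ (proj₂ sc)

  j-ι : ∀ {X : NC.Obj} (sc : StronglyCantorian X) → ⌊ j sc ⌋ ∘ ι (proj₁ X) ≈ id
  j-ι sc = proj₁ (proj₂ (proj₂ sc))

  ι-j : ∀ {X : NC.Obj} (sc : StronglyCantorian X) → ι (proj₁ X) ∘ ⌊ j sc ⌋ ≈ id
  ι-j sc = proj₂ (proj₂ (proj₂ sc))

  j-natural : ∀ {A B : NC.Obj} (scA : StronglyCantorian A) (scB : StronglyCantorian B)
                (f : proj₁ A ⇒ proj₁ B) → f ∘ ⌊ j scA ⌋ ≈ ⌊ j scB ⌋ ∘ TF.F₁ f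
  j-natural scA scB f = begin
    f ∘ jA                       ≈⟨ ≈.sym identityˡ ⟩
    id ∘ (f ∘ jA)                ≈⟨ ∘-resp-≈ (≈.sym (j-ι scB)) ≈.refl ⟩
    (jB ∘ ι _) ∘ (f ∘ jA)        ≈⟨ assoc ⟩
    jB ∘ (ι _ ∘ (f ∘ jA))        ≈⟨ ∘-resp-≈ ≈.refl (≈.sym assoc) ⟩
    jB ∘ ((ι _ ∘ f) ∘ jA)        ≈⟨ ∘-resp-≈ ≈.refl (∘-resp-≈ (≈.sym (ι-natural f)) ≈.refl) ⟩
    jB ∘ ((TF.F₁ f ∘ ι _) ∘ jA)  ≈⟨ ∘-resp-≈ ≈.refl assoc ⟩
    jB ∘ (TF.F₁ f ∘ (ι _ ∘ jA))  ≈⟨ ∘-resp-≈ ≈.refl (∘-resp-≈ ≈.refl (ι-j scA)) ⟩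
    jB ∘ (TF.F₁ f ∘ id)          ≈⟨ ∘-resp-≈ ≈.refl identityʳ ⟩
    jB ∘ TF.F₁ f                 ∎
    where
      open HomReasoning
      jA = ⌊ j scA ⌋
      jB = ⌊ j scB ⌋

  j-transport : ∀ {A B : NC.Obj} {Y} (scA : StronglyCantorian A)
                  (scB : StronglyCantorian B) (f : proj₁ A ⇒ proj₁ B) (h : Y ⇒ proj₁ A) →
                f ∘ (⌊ j scA ⌋ ∘ TF.F₁ h) ≈ ⌊ j scB ⌋ ∘ TF.F₁ (f ∘ h)
  j-transport scA scB f h = begin
    f ∘ (⌊ j scA ⌋ ∘ TF.F₁ h)         ≈⟨ ≈.sym assoc ⟩
    (f ∘ ⌊ j scA ⌋) ∘ TF.F₁ h         ≈⟨ ∘-resp-≈ (j-natural scA scB f) ≈.refl ⟩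
    (⌊ j scB ⌋ ∘ TF.F₁ f) ∘ TF.F₁ h   ≈⟨ assoc ⟩
    ⌊ j scB ⌋ ∘ (TF.F₁ f ∘ TF.F₁ h)   ≈⟨ ∘-resp-≈ ≈.refl (≈.sym TF.homomorphism) ⟩
    ⌊ j scB ⌋ ∘ TF.F₁ (f ∘ h)         ∎
    where open HomReasoning

  j-absorbs-ι : ∀ {A : NC.Obj} {Y} (scA : StronglyCantorian A) (r : Y ⇒ proj₁ A)
                  (d : TF.F₀ Y ⇒ Y) →
                r ∘ d ≈ ⌊ j scA ⌋ ∘ TF.F₁ r → r ∘ (d ∘ ι Y) ≈ r ∘ id
  j-absorbs-ι {Y = Y} scA r d rd≈jTr = begin
    r ∘ (d ∘ ι Y)                ≈⟨ ≈.sym assoc ⟩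
    (r ∘ d) ∘ ι Y                ≈⟨ ∘-resp-≈ rd≈jTr ≈.refl ⟩
    (⌊ j scA ⌋ ∘ TF.F₁ r) ∘ ι Y  ≈⟨ assoc ⟩
    ⌊ j scA ⌋ ∘ (TF.F₁ r ∘ ι Y)  ≈⟨ ∘-resp-≈ ≈.refl (ι-natural r) ⟩
    ⌊ j scA ⌋ ∘ (ι _ ∘ r)        ≈⟨ ≈.sym assoc ⟩
    (⌊ j scA ⌋ ∘ ι _) ∘ r        ≈⟨ ∘-resp-≈ (j-ι scA) ≈.refl ⟩
    id ∘ r                       ≈⟨ identityˡ ⟩
    r                            ≈⟨ ≈.sym identityʳ ⟩
    r ∘ id                       ∎
    where open HomReasoning

  pullback-StronglyCantorian :
    ∀ {A B X P : NC.Obj} {f : A NC.⇒ X} {g : B NC.⇒ X}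
      {p₁ : P NC.⇒ A} {p₂ : P NC.⇒ B} →
    NN.IsPullback f g p₁ p₂ →
    StronglyCantorian A → StronglyCantorian B → StronglyCantorian X →
    StronglyCantorian P
  pullback-StronglyCantorian {P = P} {f} {g} {p₁} {p₂} pb scA scB scX =
    retraction⇒StronglyCantorian P d
      (pullback-jointly-monic pb-in-M (⌊ d ⌋ ∘ ι (proj₁ P)) id
        (j-absorbs-ι scA ⌊ p₁ ⌋ ⌊ d ⌋ p₁d≈jTp₁)
        (j-absorbs-ι scB ⌊ p₂ ⌋ ⌊ d ⌋ p₂d≈jTp₂))
    where
      open HomReasoning
      pb-in-M : Notions.IsPullback M ⌊ f ⌋ ⌊ g ⌋ ⌊ p₁ ⌋ ⌊ p₂ ⌋
      pb-in-M = IsHeytingInclusion.pres-pullback N-inclusion {f = f} {g} {p₁} {p₂} pb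
      cone : ⌊ f ⌋ ∘ (⌊ j scA ⌋ ∘ TF.F₁ ⌊ p₁ ⌋) ≈ ⌊ g ⌋ ∘ (⌊ j scB ⌋ ∘ TF.F₁ ⌊ p₂ ⌋)
      cone = begin
        ⌊ f ⌋ ∘ (⌊ j scA ⌋ ∘ TF.F₁ ⌊ p₁ ⌋)  ≈⟨ j-transport scA scX ⌊ f ⌋ ⌊ p₁ ⌋ ⟩
        ⌊ j scX ⌋ ∘ TF.F₁ (⌊ f ⌋ ∘ ⌊ p₁ ⌋)  ≈⟨ ∘-resp-≈ ≈.refl (TF.F-resp-≈ (proj₁ pb-in-M)) ⟩
        ⌊ j scX ⌋ ∘ TF.F₁ (⌊ g ⌋ ∘ ⌊ p₂ ⌋)  ≈⟨ ≈.sym (j-transport scB scX ⌊ g ⌋ ⌊ p₂ ⌋) ⟩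
        ⌊ g ⌋ ∘ (⌊ j scB ⌋ ∘ TF.F₁ ⌊ p₂ ⌋)  ∎
      d : Tₙ P NC.⇒ P
      d = proj₁ (proj₂ pb (j scA NC.∘ Tₙ₁ p₁) (j scB NC.∘ Tₙ₁ p₂) cone)
      p₁d≈jTp₁ : ⌊ p₁ ⌋ ∘ ⌊ d ⌋ ≈ ⌊ j scA ⌋ ∘ TF.F₁ ⌊ p₁ ⌋
      p₁d≈jTp₁ = proj₁ (proj₂ (proj₂ pb (j scA NC.∘ Tₙ₁ p₁) (j scB NC.∘ Tₙ₁ p₂) cone))
      p₂d≈jTp₂ : ⌊ p₂ ⌋ ∘ ⌊ d ⌋ ≈ ⌊ j scB ⌋ ∘ TF.F₁ ⌊ p₂ ⌋
      p₂d≈jTp₂ = proj₁ (proj₂ (proj₂ (proj₂ pb (j scA NC.∘ Tₙ₁ p₁) (j scB NC.∘ Tₙ₁ p₂) cone)))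

-- Main theorem: monic in SCan iff monic in N.  The kernel pair of m in N
-- is strongly Cantorian, hence a test object in SCan.
mainTheorem12 : ∀ {o ℓ e : Level} (I : IMLU o ℓ e)
                  {A B : Category.Obj (IMLU.SCan I)}
                  (m : Category._⇒_ (IMLU.SCan I) A B) →
                  Notions.Monic (IMLU.SCan I) m
                    ⇔ Notions.Monic (IMLU.N I) (FullHom.hom m)
mainTheorem12 I {A} {B} m =
  mk⇔ (monic-from-full-sub m {p₁} {p₂} isPullback kernel-pair-StronglyCantorian)
      (monic-in-full-sub m)
  where
    open IMLU I using (N; N-heyting; StronglyCantorian)
    open FullSubcategoryFacts N StronglyCantorian
    open Notions.Pullback
           (Notions.IsHeyting.pullback N-heyting (FullHom.hom m) (FullHom.hom m))
    kernel-pair-StronglyCantorian : StronglyCantorian P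
    kernel-pair-StronglyCantorian =
      StronglyCantorianFacts.pullback-StronglyCantorian I
        {f = FullHom.hom m} {FullHom.hom m} {p₁} {p₂} isPullback
        (proj₂ A) (proj₂ A) (proj₂ B)
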